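{- For every category $\mathcal{C}$, $\mathcal{C}_{\mathcal{P}^+_\omega}$ is $\mathbf{Convex}$-enriched and $\mathcal{C}_{\mathcal{P}_\omega}$ is $\mathbf{Subconvex}$-enriched, where in both cases the (sub)convex combination of hom-set elements is given by taking the union over the support: for elements $U_i$ ($i\in I$) of a hom-set and weights $p_i>0$ (with $\sum_ip_i=1$, resp. $\sum_ip_i\le1$), $\sum_{i\in I}p_i|U_i\rangle:=\bigcup_{i\in I}U_i$ (the empty combination giving $\emptyset$ in the subconvex case).
   Context: $\mathcal{C}_{\mathcal{P}^+_\omega}$ (resp. $\mathcal{C}_{\mathcal{P}_\omega}$) has the objects of $\mathcal{C}$, hom-sets the non-empty finite (resp. all finite) subsets of $\mathcal{C}(A,B)$, composition $V\circ U=\{v\circ u\mid v\in V,u\in U\}$, identities $\{1_A\}$. A convex (resp. subconvex) algebra is an Eilenberg–Moore algebra for the finite distribution monad $D$ (resp. finite subdistribution monad $S$) on $\mathbf{Set}$, i.e. a set $H$ with a map from finitely supported distributions (resp. subdistributions) on $H$ to $H$ satisfying the unit and associativity laws. A category is $\mathbf{Convex}$-enriched (resp. $\mathbf{Subconvex}$-enriched) if its hom-sets carry convex (resp. subconvex) algebra structures with $(\sum_ip_if_i)\circ g=\sum_ip_i(f_i\circ g)$ and $f\circ(\sum_ip_ig_i)=\sum_ip_i(f\circ g_i)$ for all convex (resp. subconvex) combinations. -}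

module Defs where

open import Level using (Level; 0ℓ; _⊔_) renaming (suc to lsuc)
open import Algebra.Bundles using (CommutativeSemiring)
open import Relation.Binary.Structures using (IsPartialOrder; IsStrictPartialOrder)
open import Relation.Binary.Bundles using (Setoid)
open import Relation.Binary.PropositionalEquality using (_≡_)
import Relation.Binary.Construct.On as On
open import Data.Product using (_×_; _,_; proj₁; proj₂)
open import Data.List as L using (List; []; _∷_)
open import Data.List.NonEmpty as L⁺ using (List⁺; toList)
open import Data.List.Relation.Unary.All using (All)
open import Data.List.Relation.Binary.BagAndSetEquality using ([_]-Equality; set)

record Category (o h : Level) : Set (lsuc (o ⊔ h)) where
  infixr 9 _∘_
  field
    Obj       : Set o
    Hom       : Obj → Obj → Set h
    id        : ∀ {A} → Hom A A
    _∘_       : ∀ {A B C} → Hom B C → Hom A B → Hom A C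
    identityˡ : ∀ {A B} (f : Hom A B) → id ∘ f ≡ f
    identityʳ : ∀ {A B} (f : Hom A B) → f ∘ id ≡ f
    assoc     : ∀ {A B C D} (h : Hom C D) (g : Hom B C) (f : Hom A B) →
                (h ∘ g) ∘ f ≡ h ∘ (g ∘ f)

-- The paper's weights are non-negative reals; the standard
-- library has no reals, so we work over an arbitrary ordered commutative
-- semiring of weights (the non-negative reals being the intended
-- instance).

record Weights : Set₁ where
  field
    weightSemiring : CommutativeSemiring 0ℓ 0ℓ
  open CommutativeSemiring weightSemiring public
  field
    _≤_ : Carrier → Carrier → Set
    _<_ : Carrier → Carrier → Set
    ≤-isPartialOrder       : IsPartialOrder _≈_ _≤_
    <-isStrictPartialOrder : IsStrictPartialOrder _≈_ _<_
    <⇒≤ : ∀ {p q} → p < q → p ≤ q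
    0<1 : 0# < 1#

-- Finite (sub)distributions, represented as formal sums  Σ p_i |x_i⟩
-- (lists of weight/element pairs), modulo the congruence generated by
-- reordering and merging repeated elements.

module _ (𝕎 : Weights) where
  open Weights 𝕎 renaming (Carrier to W; _≈_ to _≈W_)

  -- formal sums (raw): subdistributions as lists, distributions as
  -- non-empty lists
  FSum : ∀ {a} → Set a → Set a
  FSum X = List (W × X)

  FSum⁺ : ∀ {a} → Set a → Set a
  FSum⁺ X = List⁺ (W × X)

  weightSum : ∀ {a} {X : Set a} → FSum X → W
  weightSum []            = 0#
  weightSum ((p , _) ∷ φ) = p + weightSum φ

  Positive : ∀ {a} {X : Set a} → FSum X → Set a
  Positive = All (λ px → 0# < proj₁ px)

  IsSubdist : ∀ {a} {X : Set a} → FSum X → Set a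
  IsSubdist φ = Positive φ × (weightSum φ ≤ 1#)

  IsDist : ∀ {a} {X : Set a} → FSum⁺ X → Set a
  IsDist φ = Positive (toList φ) × (weightSum (toList φ) ≈W 1#)

  module _ {a ℓ} (S : Setoid a ℓ) where
    open Setoid S renaming (Carrier to X; _≈_ to _≈X_)

    data _≋_ : FSum X → FSum X → Set (a ⊔ ℓ) where
      ≋-refl  : ∀ {φ} → φ ≋ φ
      ≋-sym   : ∀ {φ ψ} → φ ≋ ψ → ψ ≋ φ
      ≋-trans : ∀ {φ ψ χ} → φ ≋ ψ → ψ ≋ χ → φ ≋ χ
      ≋-cons  : ∀ {p q x y φ ψ} → p ≈W q → x ≈X y → φ ≋ ψ →
                ((p , x) ∷ φ) ≋ ((q , y) ∷ ψ)
      ≋-swap  : ∀ {u v φ} → (u ∷ v ∷ φ) ≋ (v ∷ u ∷ φ)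
      ≋-merge : ∀ {p q x y φ} → x ≈X y →
                ((p , x) ∷ (q , y) ∷ φ) ≋ ((p + q , x) ∷ φ)

  ηS : ∀ {a} {X : Set a} → X → FSum X
  ηS x = (1# , x) ∷ []

  ηD : ∀ {a} {X : Set a} → X → FSum⁺ X
  ηD x = L⁺.[ 1# , x ]

  scale : ∀ {a} {X : Set a} → W → W × X → W × X
  scale p (q , x) = (p * q , x)

  mapS : ∀ {a b} {X : Set a} {Y : Set b} → (X → Y) → FSum X → FSum Y
  mapS f = L.map (λ px → (proj₁ px , f (proj₂ px)))

  mapD : ∀ {a b} {X : Set a} {Y : Set b} → (X → Y) → FSum⁺ X → FSum⁺ Y
  mapD f = L⁺.map (λ px → (proj₁ px , f (proj₂ px)))

  μS : ∀ {a} {X : Set a} → FSum (FSum X) → FSum X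
  μS = L.concatMap (λ pφ → L.map (scale (proj₁ pφ)) (proj₂ pφ))

  μD : ∀ {a} {X : Set a} → FSum⁺ (FSum⁺ X) → FSum⁺ X
  μD = L⁺.concatMap (λ pφ → L⁺.map (scale (proj₁ pφ)) (proj₂ pφ))

  -- Eilenberg–Moore algebras: convex and subconvex algebras on a set H
  -- (presented as a setoid; the structure map must be well defined on
  -- (sub)distributions, i.e. respect _≋_).

  record IsConvexAlgebra {a ℓ} (H : Setoid a ℓ)
           (α : FSum⁺ (Setoid.Carrier H) → Setoid.Carrier H) : Set (a ⊔ ℓ) where
    open Setoid H
    field
      α-cong : ∀ (φ ψ : FSum⁺ Carrier) → IsDist φ → IsDist ψ →
               _≋_ H (toList φ) (toList ψ) → α φ ≈ α ψ
      unit   : ∀ (x : Carrier) → α (ηD x) ≈ x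
      assoc  : ∀ (Φ : FSum⁺ (FSum⁺ Carrier)) → IsDist Φ →
               All (λ pφ → IsDist (proj₂ pφ)) (toList Φ) →
               α (μD Φ) ≈ α (mapD α Φ)

  record IsSubconvexAlgebra {a ℓ} (H : Setoid a ℓ)
           (α : FSum (Setoid.Carrier H) → Setoid.Carrier H) : Set (a ⊔ ℓ) where
    open Setoid H
    field
      α-cong : ∀ (φ ψ : FSum Carrier) → IsSubdist φ → IsSubdist ψ →
               _≋_ H φ ψ → α φ ≈ α ψ
      unit   : ∀ (x : Carrier) → α (ηS x) ≈ x
      assoc  : ∀ (Φ : FSum (FSum Carrier)) → IsSubdist Φ →
               All (λ pφ → IsSubdist (proj₂ pφ)) Φ →
               α (μS Φ) ≈ α (mapS α Φ)

  record IsConvexEnriched {o a ℓ} {Obj : Set o}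
           (Hom : Obj → Obj → Setoid a ℓ)
           (_⊚_ : ∀ {A B C} → Setoid.Carrier (Hom B C) → Setoid.Carrier (Hom A B) →
                  Setoid.Carrier (Hom A C))
           (α : ∀ {A B} → FSum⁺ (Setoid.Carrier (Hom A B)) → Setoid.Carrier (Hom A B))
           : Set (o ⊔ a ⊔ ℓ) where
    field
      algebra : ∀ A B → IsConvexAlgebra (Hom A B) (α {A} {B})
      ∘-linearˡ : ∀ {A B C} (φ : FSum⁺ (Setoid.Carrier (Hom B C)))
                  (g : Setoid.Carrier (Hom A B)) → IsDist φ →
                  Setoid._≈_ (Hom A C) (α φ ⊚ g) (α (mapD (λ f → f ⊚ g) φ))
      ∘-linearʳ : ∀ {A B C} (f : Setoid.Carrier (Hom B C))
                  (ψ : FSum⁺ (Setoid.Carrier (Hom A B))) → IsDist ψ →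
                  Setoid._≈_ (Hom A C) (f ⊚ α ψ) (α (mapD (λ g → f ⊚ g) ψ))

  record IsSubconvexEnriched {o a ℓ} {Obj : Set o}
           (Hom : Obj → Obj → Setoid a ℓ)
           (_⊚_ : ∀ {A B C} → Setoid.Carrier (Hom B C) → Setoid.Carrier (Hom A B) →
                  Setoid.Carrier (Hom A C))
           (α : ∀ {A B} → FSum (Setoid.Carrier (Hom A B)) → Setoid.Carrier (Hom A B))
           : Set (o ⊔ a ⊔ ℓ) where
    field
      algebra : ∀ A B → IsSubconvexAlgebra (Hom A B) (α {A} {B})
      ∘-linearˡ : ∀ {A B C} (φ : FSum (Setoid.Carrier (Hom B C)))
                  (g : Setoid.Carrier (Hom A B)) → IsSubdist φ →
                  Setoid._≈_ (Hom A C) (α φ ⊚ g) (α (mapS (λ f → f ⊚ g) φ))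
      ∘-linearʳ : ∀ {A B C} (f : Setoid.Carrier (Hom B C))
                  (ψ : FSum (Setoid.Carrier (Hom A B))) → IsSubdist ψ →
                  Setoid._≈_ (Hom A C) (f ⊚ α ψ) (α (mapS (λ g → f ⊚ g) ψ))

-- The categories C_{P⁺ω} and C_{Pω}: hom-sets are (non-empty) finite
-- subsets of C(A,B), represented as (non-empty) lists up to set equality.

module _ {o h} (𝒞 : Category o h) where
  open Category 𝒞

  HomP : Obj → Obj → Setoid h h
  HomP A B = [ set ]-Equality (Hom A B)

  HomP⁺ : Obj → Obj → Setoid h h
  HomP⁺ A B = On.setoid ([ set ]-Equality (Hom A B)) toList

  compP : ∀ {A B C} → List (Hom B C) → List (Hom A B) → List (Hom A C)
  compP V U = L.concatMap (λ v → L.map (λ u → v ∘ u) U) V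

  compP⁺ : ∀ {A B C} → List⁺ (Hom B C) → List⁺ (Hom A B) → List⁺ (Hom A C)
  compP⁺ V U = L⁺.concatMap (λ v → L⁺.map (λ u → v ∘ u) U) V

  idP : ∀ {A} → List (Hom A A)
  idP = id ∷ []

  idP⁺ : ∀ {A} → List⁺ (Hom A A)
  idP⁺ = L⁺.[ id ]

module _ (𝕎 : Weights) {a} {X : Set a} where
  unionS : FSum 𝕎 (List X) → List X
  unionS φ = L.concatMap proj₂ φ

  unionD : FSum⁺ 𝕎 (List⁺ X) → List⁺ X
  unionD φ = L⁺.concatMap proj₂ φ

module Submission where

-- The hom-set combination  Σᵢ pᵢ|Uᵢ⟩ ↦ ⋃ᵢ Uᵢ  ignores the weights, so
-- every law to be checked is a statement about unions of lists of
-- morphisms up to set equality.  Writing  unionBy t φ  for the union of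
-- the lists  t xᵢ  over the support of a formal sum  φ = Σᵢ pᵢ|xᵢ⟩, we
-- establish, for an arbitrary  t :
--   * unionBy t is invariant under the congruence ≋ on formal sums
--     (reordering and merging of terms), since _++_ is a commutative,
--     idempotent monoid up to set equality;
--   * unionBy t satisfies the unit and multiplication laws of an
--     Eilenberg–Moore algebra, on the nose (as lists);
--   * composition of finite sets of morphisms  V ∘ U  distributes over
--     unions on the left (on the nose) and on the right (up to set
--     equality, by interchanging the two unions).
-- With t = id this is the subconvex enrichment of C_{Pω}.  For C_{P⁺ω}
-- we show that  toList  turns non-empty unions, multiplication and
-- composition into their possibly-empty counterparts, and apply the
-- same facts with t = toList.

open import Defs
open import Level using (Level)
open import Function using (_∘_; id; flip)
open import Function.Bundles using (mk⇔)
open import Data.Product using (_×_; _,_; proj₁; proj₂)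
open import Data.List as L using (List; _++_)
open import Data.List.NonEmpty as L⁺ using (List⁺; toList)
open import Data.List.Properties
  using (++-identityʳ; ++-assoc; concatMap-cong; concatMap-map; map-concatMap)
open import Data.List.NonEmpty.Properties using (toList->>=)
open import Data.List.Effectful using (module MonadProperties)
open import Data.List.Membership.Propositional using (_∈_)
import Data.List.Relation.Unary.Any as Any
open import Data.List.Relation.Unary.Any.Properties using (concatMap⁺; concatMap⁻; swap)
open import Data.List.Relation.Binary.BagAndSetEquality
  using ([_]-Equality; set; _∼[_]_; ++-cong; ++-idempotent; commutativeMonoid)
open import Algebra.Bundles using (CommutativeMonoid)
import Algebra.Properties.CommutativeSemigroup as CommSemigroupProperties
open import Relation.Binary.Bundles using (Setoid)
open import Relation.Binary.PropositionalEquality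
  using (_≡_; _≗_; sym; trans; cong; module ≡-Reasoning)
import Relation.Binary.Reasoning.Setoid as SetoidReasoning

private
  variable
    a b c ℓ : Level
    A : Set a
    B : Set b
    C : Set c

  module SetEq {x} {X : Set x} = Setoid ([ set ]-Equality X)

-- Interchange of two iterated unions: both sides contain z exactly when
-- z ∈ s x y for some x ∈ xs and y ∈ ys.
concatMap-interchange : (s : A → B → List C) (xs : List A) (ys : List B) →
  L.concatMap (λ x → L.concatMap (s x) ys) xs ∼[ set ]
  L.concatMap (λ y → L.concatMap (flip s y) xs) ys
concatMap-interchange s xs ys = mk⇔ (exchange s xs ys) (exchange (flip s) ys xs)
  where
  exchange : ∀ {a b} {A : Set a} {B : Set b} (s : A → B → List C) xs ys {z} →
    z ∈ L.concatMap (λ x → L.concatMap (s x) ys) xs →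
    z ∈ L.concatMap (λ y → L.concatMap (flip s y) xs) ys
  exchange s xs ys z∈ =
    concatMap⁺ (λ y → L.concatMap (flip s y) xs) {xs = ys}
      (Any.map (λ {y} → concatMap⁺ (flip s y) {xs = xs})
        (swap (Any.map (λ {x} → concatMap⁻ (s x) {xs = ys})
          (concatMap⁻ (λ x → L.concatMap (s x) ys) {xs = xs} z∈))))

concatMap-concatMap : {A B C : Set ℓ} (g : B → List C) (f : A → List B) (xs : List A) →
  L.concatMap g (L.concatMap f xs) ≡ L.concatMap (L.concatMap g ∘ f) xs
concatMap-concatMap g f xs = sym (MonadProperties.associative xs f g)

module _ (𝕎 : Weights) where

  unionBy : (A → List B) → FSum 𝕎 A → List B
  unionBy t = L.concatMap (t ∘ proj₂)

  unionBy-cong : {t u : A → List B} → t ≗ u → unionBy t ≗ unionBy u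
  unionBy-cong t≗u = concatMap-cong (t≗u ∘ proj₂)

  unionBy-map : (t : B → List C) (f : A → B) (φ : FSum 𝕎 A) →
    unionBy t (mapS 𝕎 f φ) ≡ unionBy (t ∘ f) φ
  unionBy-map t f = concatMap-map (t ∘ proj₂) _

  unionBy-η : (t : A → List B) (x : A) → unionBy t (ηS 𝕎 x) ≡ t x
  unionBy-η t x = ++-identityʳ (t x)

  -- Multiplication law: flattening a formal sum of formal sums only
  -- rescales weights, which the union ignores.
  unionBy-μ : {A B : Set ℓ} (t : A → List B) (Φ : FSum 𝕎 (FSum 𝕎 A)) →
    unionBy t (μS 𝕎 Φ) ≡ unionBy (unionBy t) Φ
  unionBy-μ t Φ = begin
    unionBy t (μS 𝕎 Φ)
      ≡⟨ concatMap-concatMap (t ∘ proj₂) (λ pφ → L.map (scale 𝕎 (proj₁ pφ)) (proj₂ pφ)) Φ ⟩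
    L.concatMap (λ pφ → unionBy t (L.map (scale 𝕎 (proj₁ pφ)) (proj₂ pφ))) Φ
      ≡⟨ concatMap-cong (λ pφ → concatMap-map (t ∘ proj₂) (scale 𝕎 (proj₁ pφ)) (proj₂ pφ)) Φ ⟩
    unionBy (unionBy t) Φ
      ∎
    where open ≡-Reasoning

  module _ {s ℓₛ} (S : Setoid s ℓₛ) {B : Set b}
           (t : Setoid.Carrier S → List B)
           (t-cong : ∀ {x y} → Setoid._≈_ S x y → t x ∼[ set ] t y) where

    open CommutativeMonoid (commutativeMonoid set B) using (commutativeSemigroup; ∙-congˡ; ∙-congʳ)
    open CommSemigroupProperties commutativeSemigroup using (x∙yz≈y∙xz)

    ++-absorb : (xs ys zs : List B) → xs ∼[ set ] ys →
                xs ++ ys ++ zs ∼[ set ] xs ++ zs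
    ++-absorb xs ys zs xs∼ys = begin
      xs ++ (ys ++ zs)  ≡⟨ sym (++-assoc xs ys zs) ⟩
      (xs ++ ys) ++ zs  ≈⟨ ∙-congʳ {x = zs} (∙-congˡ {x = xs} (SetEq.sym xs∼ys)) ⟩
      (xs ++ xs) ++ zs  ≈⟨ ∙-congʳ {x = zs} (++-idempotent xs) ⟩
      xs ++ zs          ∎
      where open SetoidReasoning ([ set ]-Equality B)

    unionBy-resp-≋ : ∀ {φ ψ} → _≋_ 𝕎 S φ ψ → unionBy t φ ∼[ set ] unionBy t ψ
    unionBy-resp-≋ ≋-refl           = SetEq.refl
    unionBy-resp-≋ (≋-sym e)        = SetEq.sym (unionBy-resp-≋ e)
    unionBy-resp-≋ (≋-trans e f)    = SetEq.trans (unionBy-resp-≋ e) (unionBy-resp-≋ f)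
    unionBy-resp-≋ (≋-cons _ x≈y e) = ++-cong (t-cong x≈y) (unionBy-resp-≋ e)
    unionBy-resp-≋ (≋-swap {u} {v} {φ}) = x∙yz≈y∙xz (t (proj₂ u)) (t (proj₂ v)) (unionBy t φ)
    unionBy-resp-≋ (≋-merge {x = x} {y} {φ} x≈y) = ++-absorb (t x) (t y) (unionBy t φ) (t-cong x≈y)

module _ {o h} (𝒞 : Category o h) where
  open Category 𝒞 using (Obj; Hom) renaming (_∘_ to _∘ᶜ_)

  compP-unionˡ : {X Y Z : Obj} {I : Set h} (t : I → List (Hom Y Z)) (is : List I) (U : List (Hom X Y)) →
    compP 𝒞 (L.concatMap t is) U ≡ L.concatMap (λ i → compP 𝒞 (t i) U) is
  compP-unionˡ t is U = concatMap-concatMap _ t is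

  compP-unionʳ : {X Y Z : Obj} {I : Set h} (V : List (Hom Y Z)) (t : I → List (Hom X Y)) (is : List I) →
    compP 𝒞 V (L.concatMap t is) ∼[ set ] L.concatMap (λ i → compP 𝒞 V (t i)) is
  compP-unionʳ {X} {Z = Z} V t is = begin
    L.concatMap (λ v → L.map (v ∘ᶜ_) (L.concatMap t is)) V
      ≡⟨ concatMap-cong (λ v → map-concatMap (v ∘ᶜ_) t is) V ⟩
    L.concatMap (λ v → L.concatMap (λ i → L.map (v ∘ᶜ_) (t i)) is) V
      ≈⟨ concatMap-interchange (λ v i → L.map (v ∘ᶜ_) (t i)) V is ⟩
    L.concatMap (λ i → compP 𝒞 V (t i)) is
      ∎
    where open SetoidReasoning ([ set ]-Equality (Hom X Z))

toList-concatMap⁺ : {A B : Set ℓ} (f : A → List⁺ B) (xs : List⁺ A) →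
  toList (L⁺.concatMap f xs) ≡ L.concatMap (toList ∘ f) (toList xs)
toList-concatMap⁺ f xs = sym (toList->>= f xs)

module _ (𝕎 : Weights) where

  toList-unionD : {A : Set ℓ} (φ : FSum⁺ 𝕎 (List⁺ A)) →
    toList (unionD 𝕎 φ) ≡ unionBy 𝕎 toList (toList φ)
  toList-unionD = toList-concatMap⁺ proj₂

  -- The form in which the right-hand sides of the convex laws appear.
  toList-unionD-mapD : {A B : Set ℓ} (k : A → List⁺ B) (φ : FSum⁺ 𝕎 A) →
    toList (unionD 𝕎 (mapD 𝕎 k φ)) ≡ unionBy 𝕎 (toList ∘ k) (toList φ)
  toList-unionD-mapD k φ =
    trans (toList-unionD (mapD 𝕎 k φ)) (unionBy-map 𝕎 toList k (toList φ))

  toList-μD : {A : Set ℓ} (Φ : FSum⁺ 𝕎 (FSum⁺ 𝕎 A)) →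
    toList (μD 𝕎 Φ) ≡ μS 𝕎 (mapS 𝕎 toList (toList Φ))
  toList-μD Φ = trans (toList-concatMap⁺ _ Φ)
    (sym (concatMap-map (λ pφ → L.map (scale 𝕎 (proj₁ pφ)) (proj₂ pφ))
                        (λ pφ → proj₁ pφ , toList (proj₂ pφ)) (toList Φ)))

  unionD-μD : {A : Set ℓ} (Φ : FSum⁺ 𝕎 (FSum⁺ 𝕎 (List⁺ A))) →
    toList (unionD 𝕎 (μD 𝕎 Φ)) ≡ toList (unionD 𝕎 (mapD 𝕎 (unionD 𝕎) Φ))
  unionD-μD Φ = begin
    toList (unionD 𝕎 (μD 𝕎 Φ))
      ≡⟨ toList-unionD (μD 𝕎 Φ) ⟩
    unionBy 𝕎 toList (toList (μD 𝕎 Φ))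
      ≡⟨ cong (unionBy 𝕎 toList) (toList-μD Φ) ⟩
    unionBy 𝕎 toList (μS 𝕎 (mapS 𝕎 toList (toList Φ)))
      ≡⟨ unionBy-μ 𝕎 toList (mapS 𝕎 toList (toList Φ)) ⟩
    unionBy 𝕎 (unionBy 𝕎 toList) (mapS 𝕎 toList (toList Φ))
      ≡⟨ unionBy-map 𝕎 (unionBy 𝕎 toList) toList (toList Φ) ⟩
    unionBy 𝕎 (unionBy 𝕎 toList ∘ toList) (toList Φ)
      ≡⟨ unionBy-cong 𝕎 toList-unionD (toList Φ) ⟨
    unionBy 𝕎 (toList ∘ unionD 𝕎) (toList Φ)
      ≡⟨ toList-unionD-mapD (unionD 𝕎) Φ ⟨
    toList (unionD 𝕎 (mapD 𝕎 (unionD 𝕎) Φ))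
      ∎
    where open ≡-Reasoning

module _ (𝕎 : Weights) {o h} (𝒞 : Category o h) where
  open Category 𝒞 using (Obj; Hom)

  toList-compP⁺ : {X Y Z : Obj} (V : List⁺ (Hom Y Z)) (U : List⁺ (Hom X Y)) →
    toList (compP⁺ 𝒞 V U) ≡ compP 𝒞 (toList V) (toList U)
  toList-compP⁺ V U = toList-concatMap⁺ _ V

  compP⁺-unionDˡ : {X Y Z : Obj} (φ : FSum⁺ 𝕎 (List⁺ (Hom Y Z))) (U : List⁺ (Hom X Y)) →
    toList (compP⁺ 𝒞 (unionD 𝕎 φ) U) ≡ toList (unionD 𝕎 (mapD 𝕎 (λ V → compP⁺ 𝒞 V U) φ))
  compP⁺-unionDˡ φ U = begin
    toList (compP⁺ 𝒞 (unionD 𝕎 φ) U)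
      ≡⟨ toList-compP⁺ (unionD 𝕎 φ) U ⟩
    compP 𝒞 (toList (unionD 𝕎 φ)) (toList U)
      ≡⟨ cong (λ V → compP 𝒞 V (toList U)) (toList-unionD 𝕎 φ) ⟩
    compP 𝒞 (unionBy 𝕎 toList (toList φ)) (toList U)
      ≡⟨ compP-unionˡ 𝒞 (toList ∘ proj₂) (toList φ) (toList U) ⟩
    unionBy 𝕎 (λ V → compP 𝒞 (toList V) (toList U)) (toList φ)
      ≡⟨ unionBy-cong 𝕎 (λ V → toList-compP⁺ V U) (toList φ) ⟨
    unionBy 𝕎 (λ V → toList (compP⁺ 𝒞 V U)) (toList φ)
      ≡⟨ toList-unionD-mapD 𝕎 (λ V → compP⁺ 𝒞 V U) φ ⟨
    toList (unionD 𝕎 (mapD 𝕎 (λ V → compP⁺ 𝒞 V U) φ))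
      ∎
    where open ≡-Reasoning

  compP⁺-unionDʳ : {X Y Z : Obj} (V : List⁺ (Hom Y Z)) (ψ : FSum⁺ 𝕎 (List⁺ (Hom X Y))) →
    toList (compP⁺ 𝒞 V (unionD 𝕎 ψ)) ∼[ set ] toList (unionD 𝕎 (mapD 𝕎 (compP⁺ 𝒞 V) ψ))
  compP⁺-unionDʳ {X} {Z = Z} V ψ = begin
    toList (compP⁺ 𝒞 V (unionD 𝕎 ψ))
      ≡⟨ toList-compP⁺ V (unionD 𝕎 ψ) ⟩
    compP 𝒞 (toList V) (toList (unionD 𝕎 ψ))
      ≡⟨ cong (compP 𝒞 (toList V)) (toList-unionD 𝕎 ψ) ⟩
    compP 𝒞 (toList V) (unionBy 𝕎 toList (toList ψ))
      ≈⟨ compP-unionʳ 𝒞 (toList V) (toList ∘ proj₂) (toList ψ) ⟩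
    unionBy 𝕎 (λ U → compP 𝒞 (toList V) (toList U)) (toList ψ)
      ≡⟨ unionBy-cong 𝕎 (toList-compP⁺ V) (toList ψ) ⟨
    unionBy 𝕎 (λ U → toList (compP⁺ 𝒞 V U)) (toList ψ)
      ≡⟨ toList-unionD-mapD 𝕎 (compP⁺ 𝒞 V) ψ ⟨
    toList (unionD 𝕎 (mapD 𝕎 (compP⁺ 𝒞 V) ψ))
      ∎
    where open SetoidReasoning ([ set ]-Equality (Hom X Z))

module _ (𝕎 : Weights) {o h} (𝒞 : Category o h) where

  subconvexEnriched : IsSubconvexEnriched 𝕎 (HomP 𝒞) (compP 𝒞) (unionS 𝕎)
  subconvexEnriched = record
    { algebra = λ A B → record
      { α-cong = λ φ ψ _ _ → unionBy-resp-≋ 𝕎 (HomP 𝒞 A B) id id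
      ; unit   = λ U → SetEq.reflexive (unionBy-η 𝕎 id U)
      ; assoc  = λ Φ _ _ → SetEq.reflexive
          (trans (unionBy-μ 𝕎 id Φ) (sym (unionBy-map 𝕎 id (unionS 𝕎) Φ)))
      }
    ; ∘-linearˡ = λ φ U _ → SetEq.reflexive
        (trans (compP-unionˡ 𝒞 proj₂ φ U) (sym (unionBy-map 𝕎 id (λ V → compP 𝒞 V U) φ)))
    ; ∘-linearʳ = λ V ψ _ → SetEq.trans (compP-unionʳ 𝒞 V proj₂ ψ)
        (SetEq.reflexive (sym (unionBy-map 𝕎 id (compP 𝒞 V) ψ)))
    }

  convexEnriched : IsConvexEnriched 𝕎 (HomP⁺ 𝒞) (compP⁺ 𝒞) (unionD 𝕎)
  convexEnriched = record
    { algebra = λ A B → record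
      { α-cong = λ φ ψ _ _ φ≋ψ →
          SetEq.trans (SetEq.reflexive (toList-unionD 𝕎 φ))
            (SetEq.trans (unionBy-resp-≋ 𝕎 (HomP⁺ 𝒞 A B) toList id φ≋ψ)
              (SetEq.reflexive (sym (toList-unionD 𝕎 ψ))))
      ; unit   = λ U → SetEq.reflexive (unionBy-η 𝕎 toList U)
      ; assoc  = λ Φ _ _ → SetEq.reflexive (unionD-μD 𝕎 Φ)
      }
    ; ∘-linearˡ = λ φ U _ → SetEq.reflexive (compP⁺-unionDˡ 𝕎 𝒞 φ U)
    ; ∘-linearʳ = λ V ψ _ → compP⁺-unionDʳ 𝕎 𝒞 V ψ
    }

mainTheorem14 : ∀ {o h} (𝕎 : Weights) (𝒞 : Category o h) →
    IsConvexEnriched 𝕎 (HomP⁺ 𝒞) (compP⁺ 𝒞) (unionD 𝕎)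
    × IsSubconvexEnriched 𝕎 (HomP 𝒞) (compP 𝒞) (unionS 𝕎)
mainTheorem14 𝕎 𝒞 = convexEnriched 𝕎 𝒞 , subconvexEnriched 𝕎 𝒞
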